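{- Let $\mathfrak{F}_1=\langle W_1,R_1\rangle$ and $\mathfrak{F}_2=\langle W_2,R_2\rangle$ be $\mathbf{S4}$ frames with $W_1\cap W_2=\emptyset$, and let $\mathfrak{F}_1\otimes\mathfrak{F}_2=\langle W,R\rangle$ be their connected product. Then the partial function on $W\times W$ with domain $W_1\times W_2$ sending $\langle w_1,w_2\rangle$ to the point $\langle w_1,w_2\rangle\in W$ is a normal hereditary union function in $\mathfrak{F}_1\otimes\mathfrak{F}_2$.
   Context: An $\mathbf{S4}$ frame is a set with a reflexive transitive relation. The connected product $\mathfrak{F}_1\otimes\mathfrak{F}_2=\langle W,R\rangle$ has $W=W_1\cup W_2\cup(W_1\times W_2)$ (assumed disjoint union) and $R=R_1\cup R_2\cup\{\langle\langle w_1,w_2\rangle,t\rangle : w_1R_1t$, or $w_2R_2t$, or $t=\langle v_1,v_2\rangle$ for some $v_1,v_2$ with $w_1R_1v_1$ and $w_2R_2v_2\}$. For a frame $\langle W,R\rangle$, a partial function $f:W\times W\rightharpoonup W$ is a hereditary union function if $\mathrm{dom}(f)$ is closed under $R^\sharp$-successors (where $\langle w,v\rangle R^\sharp\langle w',v'\rangle$ iff $wRw'$ and $vRv'$), and for every $\langle w,v\rangle\in\mathrm{dom}(f)$: $f(w,v)Rw$, $f(w,v)Rv$, and for every $t$ with $f(w,v)Rt$, either $wRt$, or $vRt$, or there are $w',v'$ with $wRw'$, $vRv'$ and $t=f(w',v')$. It is normal if for all $\langle w,v\rangle,\langle w',v'\rangle\in\mathrm{dom}(f)$ with $wRw'$ and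 $vRv'$ we have $f(w,v)Rf(w',v')$. -}

module Defs where

open import Level using (Level; _⊔_; suc)
open import Data.Product using (Σ; ∃; ∃-syntax; _×_; _,_)
open import Data.Sum using (_⊎_)
open import Relation.Binary.PropositionalEquality using (_≡_)
open import Relation.Binary.Definitions using (Reflexive; Transitive)

record S4Frame (a r : Level) : Set (suc (a ⊔ r)) where
  field
    W     : Set a
    R     : W → W → Set r
    refl  : Reflexive R
    trans : Transitive R

data CPoint {a b : Level} (W₁ : Set a) (W₂ : Set b) : Set (a ⊔ b) where
  left  : W₁ → CPoint W₁ W₂
  right : W₂ → CPoint W₁ W₂
  pair  : W₁ → W₂ → CPoint W₁ W₂

module _ {a r b s : Level} (F₁ : S4Frame a r) (F₂ : S4Frame b s) where
  private
    module F₁ = S4Frame F₁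
    module F₂ = S4Frame F₂

  data CR : CPoint F₁.W F₂.W → CPoint F₁.W F₂.W → Set (a ⊔ b ⊔ r ⊔ s) where
    l-l : ∀ {w t} → F₁.R w t → CR (left w) (left t)
    r-r : ∀ {w t} → F₂.R w t → CR (right w) (right t)
    p-l : ∀ {w₁ w₂ t} → F₁.R w₁ t → CR (pair w₁ w₂) (left t)
    p-r : ∀ {w₁ w₂ t} → F₂.R w₂ t → CR (pair w₁ w₂) (right t)
    p-p : ∀ {w₁ w₂ v₁ v₂} → F₁.R w₁ v₁ → F₂.R w₂ v₂ → CR (pair w₁ w₂) (pair v₁ v₂)

record PartialFun {a d : Level} (W : Set a) : Set (a ⊔ suc d) where
  field
    dom : W → W → Set d
    app : ∀ w v → dom w v → W

module _ {a r d : Level} {W : Set a} (R : W → W → Set r) (f : PartialFun {d = d} W) where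
  open PartialFun f

  record IsHereditaryUnion : Set (a ⊔ r ⊔ d) where
    field
      dom-closed : ∀ {w v w' v'} → dom w v → R w w' → R v v' → dom w' v'
      below-left  : ∀ {w v} (p : dom w v) → R (app w v p) w
      below-right : ∀ {w v} (p : dom w v) → R (app w v p) v
      union : ∀ {w v} (p : dom w v) (t : W) → R (app w v p) t →
        R w t ⊎ (R v t ⊎
          (Σ W λ w' → Σ W λ v' → Σ (dom w' v') λ q →
             R w w' × R v v' × t ≡ app w' v' q))

  IsNormal : Set (a ⊔ r ⊔ d)
  IsNormal = ∀ {w v w' v'} (p : dom w v) (q : dom w' v') →
    R w w' → R v v' → R (app w v p) (app w' v' q)

  IsNormalHereditaryUnion : Set (a ⊔ r ⊔ d)
  IsNormalHereditaryUnion = IsHereditaryUnion × IsNormal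

module _ {a r b s : Level} (F₁ : S4Frame a r) (F₂ : S4Frame b s) where
  private
    module F₁ = S4Frame F₁
    module F₂ = S4Frame F₂

  data PairDom : CPoint F₁.W F₂.W → CPoint F₁.W F₂.W → Set (a ⊔ b) where
    in-dom : ∀ w₁ w₂ → PairDom (left w₁) (right w₂)

  pairFun : PartialFun {d = a ⊔ b} (CPoint F₁.W F₂.W)
  pairFun = record
    { dom = PairDom
    ; app = λ { _ _ (in-dom w₁ w₂) → pair w₁ w₂ } }

{-# OPTIONS --safe #-}
module Submission where

open import Defs
open import Level using (Level)
open import Data.Product using (_,_)
open import Data.Sum using (inj₁; inj₂)
open import Relation.Binary.PropositionalEquality using (refl)

module _ {a r b s : Level} (F₁ : S4Frame a r) (F₂ : S4Frame b s) where
  private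
    module F₁ = S4Frame F₁
    module F₂ = S4Frame F₂

  PairDom-closed : ∀ {w v w' v'} → PairDom F₁ F₂ w v →
    CR F₁ F₂ w w' → CR F₁ F₂ v v' → PairDom F₁ F₂ w' v'
  PairDom-closed (in-dom _ _) (l-l _) (r-r _) = in-dom _ _

  pair-below-left : ∀ w₁ w₂ → CR F₁ F₂ (pair w₁ w₂) (left w₁)
  pair-below-left _ _ = p-l F₁.refl

  pair-below-right : ∀ w₁ w₂ → CR F₁ F₂ (pair w₁ w₂) (right w₂)
  pair-below-right _ _ = p-r F₂.refl

  pairFun-isHereditaryUnion : IsHereditaryUnion (CR F₁ F₂) (pairFun F₁ F₂)
  pairFun-isHereditaryUnion = record
    { dom-closed  = PairDom-closed
    ; below-left  = λ { (in-dom w₁ w₂) → pair-below-left w₁ w₂ }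
    ; below-right = λ { (in-dom w₁ w₂) → pair-below-right w₁ w₂ }
    ; union       = λ
        { (in-dom _ _) _ (p-l w₁Rt) → inj₁ (l-l w₁Rt)
        ; (in-dom _ _) _ (p-r w₂Rt) → inj₂ (inj₁ (r-r w₂Rt))
        ; (in-dom _ _) _ (p-p w₁Rv₁ w₂Rv₂) →
            inj₂ (inj₂ (left _ , right _ , in-dom _ _ , l-l w₁Rv₁ , r-r w₂Rv₂ , refl))
        }
    }

  pairFun-isNormal : IsNormal (CR F₁ F₂) (pairFun F₁ F₂)
  pairFun-isNormal (in-dom _ _) (in-dom _ _) (l-l w₁Rv₁) (r-r w₂Rv₂) = p-p w₁Rv₁ w₂Rv₂

lemma18 : {a r b s : Level} (F₁ : S4Frame a r) (F₂ : S4Frame b s) →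
    IsNormalHereditaryUnion (CR F₁ F₂) (pairFun F₁ F₂)
lemma18 F₁ F₂ = pairFun-isHereditaryUnion F₁ F₂ , pairFun-isNormal F₁ F₂
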